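{- Let $\mathcal{P}$ be a hereditary property of tournaments. Suppose $k$-structures of Type 1 occur in $\mathcal{P}$ for arbitrarily large values of $k$. Then $|\mathcal{P}_n| \geq 2^{n-1} - 2\binom{n-1}{2} - n$ for every $n \in \mathbb{N}$.
   Context: Tournaments are unlabelled; a hereditary property of tournaments is a class closed under isomorphism and induced sub-tournaments; $\mathcal{P}_n$ is the set of its members on $n$ vertices. A $k$-structure of Type 1 in a tournament $T$: distinct vertices $x_1,\ldots,x_{2k},y$ with $x_i \to x_j$ for $i<j$, and for each $i \in [2k-1]$, $y \to x_i$ if and only if $x_{i+1} \to y$. "Occurs in $\mathcal{P}$" means some tournament in $\mathcal{P}$ contains such a structure. -}

module Defs where

open import Data.Nat using (ℕ; suc; _*_; _≤_; _<_)
open import Data.Fin using (Fin; toℕ)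
open import Data.Bool using (Bool; true; false; not)
open import Data.Product using (Σ; ∃; _×_; _,_)
open import Relation.Binary.PropositionalEquality using (_≡_; _≢_)
open import Function.Definitions using (Injective)
open import Function.Bundles using (_↔_; Inverse)

-- A tournament on the vertex set Fin n: adj i j ≡ true means i → j.
record Tournament (n : ℕ) : Set where
  field
    adj    : Fin n → Fin n → Bool
    irrefl : ∀ i → adj i i ≡ false
    tourn  : ∀ i j → i ≢ j → adj j i ≡ not (adj i j)
open Tournament public

_≅_ : ∀ {n m} → Tournament n → Tournament m → Set
_≅_ {n} {m} S T =
  Σ (Fin n ↔ Fin m) λ σ →
    ∀ i j → adj S i j ≡ adj T (Inverse.to σ i) (Inverse.to σ j)

_↪_ : ∀ {n m} → Tournament m → Tournament n → Set
_↪_ {n} {m} S T =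
  Σ (Fin m → Fin n) λ f → Injective _≡_ _≡_ f ×
    (∀ i j → adj S i j ≡ adj T (f i) (f j))

Property : Set₁
Property = ∀ {n} → Tournament n → Set

Hereditary : Property → Set
Hereditary P =
  (∀ {n m} (S : Tournament m) (T : Tournament n) → S ≅ T → P S → P T) ×
  (∀ {n m} (S : Tournament m) (T : Tournament n) → S ↪ T → P T → P S)

Type1 : ∀ {n} → ℕ → Tournament n → Set
Type1 {n} k T =
  Σ (Fin (2 * k) → Fin n) λ x → Σ (Fin n) λ y →
    Injective _≡_ _≡_ x ×
    (∀ i → y ≢ x i) ×
    (∀ i j → toℕ i < toℕ j → adj T (x i) (x j) ≡ true) ×
    (∀ i j → toℕ j ≡ suc (toℕ i) → adj T y (x i) ≡ adj T (x j) y)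

OccursType1 : Property → ℕ → Set
OccursType1 P k = Σ ℕ λ n → Σ (Tournament n) λ T → P T × Type1 k T

-- |P_n| ≥ m : P contains m pairwise non-isomorphic tournaments on n vertices.
AtLeast : Property → ℕ → ℕ → Set
AtLeast P n m =
  Σ (Fin m → Tournament n) λ F →
    (∀ i → P (F i)) × (∀ i j → F i ≅ F j → i ≡ j)

-- Take a Type 1 structure (x₁ … x_{2k}, y) in some T ∈ P with k ≥ n − 1. As y → x_i
-- alternates along consecutive x's, any word s ∈ {0,1}^{n−1} can be read off along one
-- of x_{2i−1}, x_{2i} for each i; so P contains T_s, a transitive tournament on n − 1
-- vertices plus an apex dominating the i-th of them iff s_i = 1. Call t robustly
-- inverted if every position avoids some inversion (i < j, t_i = 1, t_j = 0), i.e. some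
-- 3-cycle apex → i → j → apex of T_t. Then an isomorphism T_s ≅ T_t fixes the apex,
-- since every 3-cycle of T_s passes through it; so it is an order automorphism of the
-- transitive part, hence the identity, and s = t. At most 2·C(n−1,2) + n words fail a
-- simple sufficient test for robust inversion.

module Submission where

open import Defs
open import Data.Nat using (ℕ; _*_; _∸_; _^_; _≤_)
open import Data.Nat.Combinatorics using (_C_)
open import Data.Product using (Σ; _×_)

open import Data.Nat as ℕ using (zero; suc; _+_; z≤n; z<s; s<s)
import Data.Nat.Properties as ℕ
open import Data.Nat.Combinatorics using (nC1≡n; nCk+nC[k+1]≡[n+1]C[k+1])
open import Data.Nat.Solver using (module +-*-Solver)
open import Algebra.Properties.CommutativeSemigroup ℕ.+-commutativeSemigroup using (interchange)
open import Data.Bool using (Bool; true; false; not; _∧_; _∨_; if_then_else_; T; _≟_)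
open import Data.Bool.Properties using (∧-comm; not-involutive; not-injective; ¬-not)
open import Data.Vec using (Vec; []; _∷_; lookup; head; tail; tabulate)
open import Data.Vec.Properties using (tabulate∘lookup; tabulate-cong)
open import Data.Fin as Fin
  using (Fin; zero; suc; toℕ; fromℕ<; inject₁; inject≤; _<_; _<?_; splitAt; _↑ˡ_; _↑ʳ_)
open import Data.Fin.Properties
  using (suc-injective; toℕ<n; toℕ-fromℕ<; toℕ-inject₁; ≤̄⇒inject₁<; inject≤-injective;
         splitAt⁻¹-↑ˡ; splitAt⁻¹-↑ʳ; <-irrefl; <-asym; <-trans; <-cmp; <⇒≢; ≤-antisym)
open import Data.Fin.Induction using (<-weakInduction)
open import Data.Product using (∃₂; _,_; proj₁; proj₂)
open import Data.Sum using (_⊎_; inj₁; inj₂; [_,_]′)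
open import Data.Empty using (⊥-elim)
open import Function using (_∘_; _↔_; Inverse; Injection)
open import Function.Definitions using (Injective)
open import Function.Properties.Inverse using (Inverse⇒Injection)
open import Relation.Binary using (tri<; tri≈; tri>; _Preserves_⟶_)
open import Relation.Nullary using (¬_; does; yes; no)
open import Relation.Nullary.Decidable using (dec-true; dec-false)
open import Relation.Binary.PropositionalEquality

hasFalse : ∀ {L} → Vec Bool L → Bool
hasFalse []          = false
hasFalse (false ∷ _) = true
hasFalse (true  ∷ s) = hasFalse s

hasTwoFalses : ∀ {L} → Vec Bool L → Bool
hasTwoFalses []          = false
hasTwoFalses (false ∷ s) = hasFalse s
hasTwoFalses (true  ∷ s) = hasTwoFalses s

hasInversion : ∀ {L} → Vec Bool L → Bool
hasInversion []          = false
hasInversion (false ∷ s) = hasInversion s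
hasInversion (true  ∷ s) = hasFalse s

hasInversion⇒hasFalse : ∀ {L} (s : Vec Bool L) → hasInversion s ≡ true → hasFalse s ≡ true
hasInversion⇒hasFalse (false ∷ s) _ = refl
hasInversion⇒hasFalse (true  ∷ s) h = h

hasTwoFalses⇒hasFalse : ∀ {L} (s : Vec Bool L) → hasTwoFalses s ≡ true → hasFalse s ≡ true
hasTwoFalses⇒hasFalse (false ∷ s) _ = refl
hasTwoFalses⇒hasFalse (true  ∷ s) h = hasTwoFalses⇒hasFalse s h

Inversion : ∀ {L} → Vec Bool L → Fin L → Fin L → Set
Inversion s i j = i < j × lookup s i ≡ true × lookup s j ≡ false

RobustlyInverted : ∀ {L} → Vec Bool L → Set
RobustlyInverted s = ∀ k → ∃₂ λ i j → i ≢ k × j ≢ k × Inversion s i j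

-- A decidable sufficient condition for RobustlyInverted, chosen so that the words
-- failing it satisfy a simple counting recursion.
robust : ∀ {L} → Vec Bool L → Bool
robust []          = false
robust (false ∷ s) = robust s
robust (true  ∷ s) = robust s ∨ (hasInversion s ∧ hasTwoFalses s)

Inversion-∷ : ∀ {L} b (s : Vec Bool L) {i j} → Inversion s i j → Inversion (b ∷ s) (suc i) (suc j)
Inversion-∷ b s (i<j , sᵢ , sⱼ) = s<s i<j , sᵢ , sⱼ

RobustlyInverted-∷ : ∀ {L} b (s : Vec Bool (suc L)) → RobustlyInverted s → RobustlyInverted (b ∷ s)
RobustlyInverted-∷ b s r zero with r zero
... | i , j , _ , _ , inv = suc i , suc j , (λ ()) , (λ ()) , Inversion-∷ b s inv
RobustlyInverted-∷ b s r (suc k) with r k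
... | i , j , i≢k , j≢k , inv =
  suc i , suc j , i≢k ∘ suc-injective , j≢k ∘ suc-injective , Inversion-∷ b s inv

hasFalse-sound : ∀ {L} (s : Vec Bool L) → hasFalse s ≡ true → Σ (Fin L) λ j → lookup s j ≡ false
hasFalse-sound (false ∷ s) _ = zero , refl
hasFalse-sound (true  ∷ s) h with hasFalse-sound s h
... | j , sⱼ = suc j , sⱼ

hasTwoFalses-sound : ∀ {L} (s : Vec Bool L) → hasTwoFalses s ≡ true →
  ∀ k → Σ (Fin L) λ j → j ≢ k × lookup s j ≡ false
hasTwoFalses-sound (false ∷ s) h zero with hasFalse-sound s h
... | j , sⱼ = suc j , (λ ()) , sⱼ
hasTwoFalses-sound (false ∷ s) h (suc k) = zero , (λ ()) , refl
hasTwoFalses-sound (true  ∷ s) h zero with hasFalse-sound s (hasTwoFalses⇒hasFalse s h)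
... | j , sⱼ = suc j , (λ ()) , sⱼ
hasTwoFalses-sound (true  ∷ s) h (suc k) with hasTwoFalses-sound s h k
... | j , j≢k , sⱼ = suc j , j≢k ∘ suc-injective , sⱼ

hasInversion-sound : ∀ {L} (s : Vec Bool L) → hasInversion s ≡ true → ∃₂ (Inversion s)
hasInversion-sound (false ∷ s) h with hasInversion-sound s h
... | i , j , inv = suc i , suc j , Inversion-∷ false s inv
hasInversion-sound (true  ∷ s) h with hasFalse-sound s h
... | j , sⱼ = zero , suc j , z<s , refl , sⱼ

-- An inversion inside s avoids the leading true; any other position is avoided by
-- the leading true together with one of the two falses of s.
robust-sound : ∀ {L} (s : Vec Bool L) → robust s ≡ true → RobustlyInverted s
robust-sound (false ∷ c ∷ s) h = RobustlyInverted-∷ false (c ∷ s) (robust-sound (c ∷ s) h)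
robust-sound (true ∷ s) h with robust s in r
robust-sound (true ∷ c ∷ s) h | true = RobustlyInverted-∷ true (c ∷ s) (robust-sound (c ∷ s) r)
robust-sound (true ∷ s) h | false with hasInversion s in inv | hasTwoFalses s in two
... | true | true = λ where
  zero    → let (i , j , i<j) = hasInversion-sound s inv
            in suc i , suc j , (λ ()) , (λ ()) , Inversion-∷ true s i<j
  (suc k) → let (j , j≢k , sⱼ) = hasTwoFalses-sound s two k
            in zero , suc j , (λ ()) , j≢k ∘ suc-injective , z<s , refl , sⱼ

count : ∀ L → (Vec Bool L → Bool) → ℕ
count zero    p = if p [] then 1 else 0
count (suc L) p = count L (p ∘ (false ∷_)) + count L (p ∘ (true ∷_))

count-cong : ∀ L {p q : Vec Bool L → Bool} → (∀ s → p s ≡ q s) → count L p ≡ count L q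
count-cong zero    p≗q = cong (if_then 1 else 0) (p≗q [])
count-cong (suc L) p≗q =
  cong₂ _+_ (count-cong L (p≗q ∘ (false ∷_))) (count-cong L (p≗q ∘ (true ∷_)))

count-mono : ∀ L {p q : Vec Bool L → Bool} →
  (∀ s → p s ≡ true → q s ≡ true) → count L p ≤ count L q
count-mono zero {p} p⇒q with p [] in e
... | true  rewrite p⇒q [] e = ℕ.≤-refl
... | false = z≤n
count-mono (suc L) p⇒q =
  ℕ.+-mono-≤ (count-mono L (p⇒q ∘ (false ∷_))) (count-mono L (p⇒q ∘ (true ∷_)))

count-false : ∀ L → count L (λ _ → false) ≡ 0
count-false zero    = refl
count-false (suc L) = cong₂ _+_ (count-false L) (count-false L)

count-+-count-not : ∀ L (p : Vec Bool L → Bool) → count L p + count L (not ∘ p) ≡ 2 ^ L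
count-+-count-not zero p with p []
... | true  = refl
... | false = refl
count-+-count-not (suc L) p = begin
  (count L p₀ + count L p₁) + (count L (not ∘ p₀) + count L (not ∘ p₁))
    ≡⟨ interchange (count L p₀) (count L p₁) (count L (not ∘ p₀)) (count L (not ∘ p₁)) ⟩
  (count L p₀ + count L (not ∘ p₀)) + (count L p₁ + count L (not ∘ p₁))
    ≡⟨ cong₂ _+_ (count-+-count-not L p₀) (count-+-count-not L p₁) ⟩
  2 ^ L + 2 ^ L
    ≡⟨ cong (2 ^ L +_) (ℕ.+-identityʳ (2 ^ L)) ⟨
  2 ^ suc L ∎
  where
  open ≡-Reasoning
  p₀ p₁ : Vec Bool L → Bool
  p₀ = p ∘ (false ∷_)
  p₁ = p ∘ (true ∷_)

∧-absorbs-implied : ∀ {a b} → (a ≡ true → b ≡ true) → a ∧ b ≡ a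
∧-absorbs-implied {false} _   = refl
∧-absorbs-implied {true}  a⇒b = a⇒b refl

not-∨⇒notʳ : ∀ a {b} → not (a ∨ b) ≡ true → not b ≡ true
not-∨⇒notʳ false h = h

count-not-hasFalse : ∀ L → count L (not ∘ hasFalse) ≤ 1
count-not-hasFalse zero    = ℕ.≤-refl
count-not-hasFalse (suc L) rewrite count-false L = count-not-hasFalse L

count-not-hasTwoFalses : ∀ L → count L (not ∘ hasTwoFalses) ≤ suc L
count-not-hasTwoFalses zero    = ℕ.≤-refl
count-not-hasTwoFalses (suc L) = ℕ.+-mono-≤ (count-not-hasFalse L) (count-not-hasTwoFalses L)

count-not-hasInversion : ∀ L → count L (not ∘ hasInversion) ≤ suc L
count-not-hasInversion zero    = ℕ.≤-refl
count-not-hasInversion (suc L) = begin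
  count L (not ∘ hasInversion) + count L (not ∘ hasFalse)
    ≤⟨ ℕ.+-mono-≤ (count-not-hasInversion L) (count-not-hasFalse L) ⟩
  suc L + 1
    ≡⟨ ℕ.+-comm (suc L) 1 ⟩
  suc (suc L) ∎
  where open ℕ.≤-Reasoning

count-not-inversionAndTwoFalses : ∀ L → count L (λ s → not (hasInversion s ∧ hasTwoFalses s)) ≤ L + suc L
count-not-inversionAndTwoFalses zero    = ℕ.≤-refl
count-not-inversionAndTwoFalses (suc L) = begin
  count L (λ s → not (hasInversion s ∧ hasFalse s)) + count L (λ s → not (hasFalse s ∧ hasTwoFalses s))
    ≡⟨ cong₂ _+_ (count-cong L (cong not ∘ inversion∧false≡inversion))
                 (count-cong L (cong not ∘ false∧twoFalses≡twoFalses)) ⟩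
  count L (not ∘ hasInversion) + count L (not ∘ hasTwoFalses)
    ≤⟨ ℕ.+-mono-≤ (count-not-hasInversion L) (count-not-hasTwoFalses L) ⟩
  suc L + suc L
    ≤⟨ ℕ.+-monoʳ-≤ (suc L) (ℕ.n≤1+n (suc L)) ⟩
  suc L + suc (suc L) ∎
  where
  open ℕ.≤-Reasoning
  inversion∧false≡inversion : ∀ (s : Vec Bool L) → hasInversion s ∧ hasFalse s ≡ hasInversion s
  inversion∧false≡inversion s = ∧-absorbs-implied (hasInversion⇒hasFalse s)
  false∧twoFalses≡twoFalses : ∀ (s : Vec Bool L) → hasFalse s ∧ hasTwoFalses s ≡ hasTwoFalses s
  false∧twoFalses≡twoFalses s = trans (∧-comm (hasFalse s) _) (∧-absorbs-implied (hasTwoFalses⇒hasFalse s))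

count-not-robust : ∀ L → count L (not ∘ robust) ≤ 2 * (L C 2) + suc L
count-not-robust zero    = ℕ.≤-refl
count-not-robust (suc L) = begin
  count L (not ∘ robust) + count L (λ s → not (robust s ∨ (hasInversion s ∧ hasTwoFalses s)))
    ≤⟨ ℕ.+-mono-≤ (count-not-robust L) (count-mono L λ s → not-∨⇒notʳ (robust s)) ⟩
  2 * (L C 2) + suc L + count L (λ s → not (hasInversion s ∧ hasTwoFalses s))
    ≤⟨ ℕ.+-monoʳ-≤ (2 * (L C 2) + suc L) (count-not-inversionAndTwoFalses L) ⟩
  2 * (L C 2) + suc L + (L + suc L)
    ≡⟨ rearrange L (L C 2) ⟩
  2 * (L + L C 2) + suc (suc L)
    ≡⟨ cong (λ c → 2 * c + suc (suc L)) pascal ⟩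
  2 * (suc L C 2) + suc (suc L) ∎
  where
  open ℕ.≤-Reasoning
  open +-*-Solver
  rearrange : ∀ L c → 2 * c + suc L + (L + suc L) ≡ 2 * (L + c) + suc (suc L)
  rearrange = solve 2 (λ L c → con 2 :* c :+ (con 1 :+ L) :+ (L :+ (con 1 :+ L))
                             := con 2 :* (L :+ c) :+ (con 2 :+ L)) refl
  pascal : L + L C 2 ≡ suc L C 2
  pascal = trans (cong (_+ L C 2) (sym (nC1≡n L))) (nCk+nC[k+1]≡[n+1]C[k+1] L 1)

count-robust : ∀ L → 2 ^ L ∸ 2 * (L C 2) ∸ suc L ≤ count L robust
count-robust L = begin
  2 ^ L ∸ 2 * (L C 2) ∸ suc L   ≡⟨ ℕ.∸-+-assoc (2 ^ L) (2 * (L C 2)) (suc L) ⟩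
  2 ^ L ∸ (2 * (L C 2) + suc L) ≤⟨ ℕ.∸-monoʳ-≤ (2 ^ L) (count-not-robust L) ⟩
  2 ^ L ∸ bad                   ≡⟨ cong (_∸ bad) (count-+-count-not L robust) ⟨
  count L robust + bad ∸ bad    ≡⟨ ℕ.m+n∸n≡m (count L robust) bad ⟩
  count L robust                ∎
  where
  open ℕ.≤-Reasoning
  bad = count L (not ∘ robust)

enumerate : ∀ L (p : Vec Bool L → Bool) → Fin (count L p) → Vec Bool L
enumerate zero    p _ = []
enumerate (suc L) p i =
  [ (false ∷_) ∘ enumerate L (p ∘ (false ∷_)) , (true ∷_) ∘ enumerate L (p ∘ (true ∷_)) ]′
    (splitAt (count L (p ∘ (false ∷_))) i)

enumerate-sound : ∀ L (p : Vec Bool L → Bool) i → p (enumerate L p i) ≡ true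
enumerate-sound zero p i with p []
enumerate-sound zero p i  | true = refl
enumerate-sound zero p () | false
enumerate-sound (suc L) p i with splitAt (count L (p ∘ (false ∷_))) i
... | inj₁ i₀ = enumerate-sound L (p ∘ (false ∷_)) i₀
... | inj₂ i₁ = enumerate-sound L (p ∘ (true ∷_)) i₁

enumerate-injective : ∀ L (p : Vec Bool L → Bool) i j → enumerate L p i ≡ enumerate L p j → i ≡ j
enumerate-injective zero p i j _ with p []
enumerate-injective zero p zero zero _ | true = refl
enumerate-injective (suc L) p i j e
  with splitAt (count L (p ∘ (false ∷_))) i in eᵢ | splitAt (count L (p ∘ (false ∷_))) j in eⱼ
... | inj₁ i₀ | inj₁ j₀ = begin
  i                 ≡⟨ splitAt⁻¹-↑ˡ eᵢ ⟨
  i₀ ↑ˡ _           ≡⟨ cong (_↑ˡ _) (enumerate-injective L _ i₀ j₀ (cong tail e)) ⟩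
  j₀ ↑ˡ _           ≡⟨ splitAt⁻¹-↑ˡ eⱼ ⟩
  j                 ∎
  where open ≡-Reasoning
... | inj₂ i₁ | inj₂ j₁ = begin
  i                 ≡⟨ splitAt⁻¹-↑ʳ eᵢ ⟨
  _ ↑ʳ i₁           ≡⟨ cong (_ ↑ʳ_) (enumerate-injective L _ i₁ j₁ (cong tail e)) ⟩
  _ ↑ʳ j₁           ≡⟨ splitAt⁻¹-↑ʳ eⱼ ⟩
  j                 ∎
  where open ≡-Reasoning
... | inj₁ _ | inj₂ _ with () ← cong head e
... | inj₂ _ | inj₁ _ with () ← cong head e

strictMono⇒injective : ∀ {m n} {f : Fin m → Fin n} → f Preserves _<_ ⟶ _<_ → Injective _≡_ _≡_ f
strictMono⇒injective {f = f} f-mono {i} {j} fi≡fj with <-cmp i j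
... | tri< i<j _ _ = ⊥-elim (<⇒≢ (f-mono i<j) fi≡fj)
... | tri≈ _ i≡j _ = i≡j
... | tri> _ _ j<i = ⊥-elim (<⇒≢ (f-mono j<i) (sym fi≡fj))

strictMono⇒inflationary : ∀ {n} {f : Fin (suc n) → Fin (suc n)} →
  f Preserves _<_ ⟶ _<_ → ∀ a → a Fin.≤ f a
strictMono⇒inflationary {f = f} f-mono = <-weakInduction (λ a → a Fin.≤ f a) z≤n step
  where
  step : ∀ i → inject₁ i Fin.≤ f (inject₁ i) → suc i Fin.≤ f (suc i)
  step i ih = subst (λ m → suc m ≤ toℕ (f (suc i))) (toℕ-inject₁ i)
                    (ℕ.≤-<-trans ih (f-mono (≤̄⇒inject₁< ℕ.≤-refl)))

strictMono-↔⇒id : ∀ {n} (σ : Fin n ↔ Fin n) → Inverse.to σ Preserves _<_ ⟶ _<_ →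
  ∀ a → Inverse.to σ a ≡ a
strictMono-↔⇒id {suc n} σ to-mono a =
  ≤-antisym (subst (to a Fin.≤_) (strictlyInverseʳ a) (strictMono⇒inflationary from-mono (to a)))
            (strictMono⇒inflationary to-mono a)
  where
  open Inverse σ using (to; from; strictlyInverseˡ; strictlyInverseʳ)
  from-mono : from Preserves _<_ ⟶ _<_
  from-mono {a} {b} a<b with <-cmp (from a) (from b)
  ... | tri< lt _ _ = lt
  ... | tri≈ _ eq _ =
    ⊥-elim (<⇒≢ a<b (trans (sym (strictlyInverseˡ a)) (trans (cong to eq) (strictlyInverseˡ b))))
  ... | tri> _ _ gt =
    ⊥-elim (<-asym a<b (subst₂ _<_ (strictlyInverseˡ b) (strictlyInverseˡ a) (to-mono gt)))

increasing⇒adj≡does : ∀ {m N} (T : Tournament N) (x : Fin m → Fin N) → Injective _≡_ _≡_ x →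
  (∀ i j → i < j → adj T (x i) (x j) ≡ true) → ∀ i j → adj T (x i) (x j) ≡ does (i <? j)
increasing⇒adj≡does T x x-inj x-incr i j with <-cmp i j
... | tri< i<j _ _ = trans (x-incr i j i<j) (sym (dec-true (i <? j) i<j))
... | tri≈ _ refl _ = trans (irrefl T (x i)) (sym (dec-false (i <? i) (<-irrefl refl)))
... | tri> _ _ j<i = begin
  adj T (x i) (x j)       ≡⟨ tourn T (x j) (x i) (<⇒≢ j<i ∘ x-inj) ⟩
  not (adj T (x j) (x i)) ≡⟨ cong not (x-incr j i j<i) ⟩
  false                   ≡⟨ dec-false (i <? j) (<-asym j<i) ⟨
  does (i <? j)           ∎
  where open ≡-Reasoning

Cycle : ∀ {n} → Tournament n → Fin n → Fin n → Fin n → Set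
Cycle T u v w = adj T u v ≡ true × adj T v w ≡ true × adj T w u ≡ true

≅-from-adj : ∀ {m n} {S : Tournament m} {T : Tournament n} ((σ , _) : S ≅ T) →
  ∀ a b → adj S (Inverse.from σ a) (Inverse.from σ b) ≡ adj T a b
≅-from-adj {T = T} (σ , σ-adj) a b =
  trans (σ-adj (from a) (from b)) (cong₂ (adj T) (strictlyInverseˡ a) (strictlyInverseˡ b))
  where open Inverse σ using (from; strictlyInverseˡ)

≅-from-cycle : ∀ {m n} {S : Tournament m} {T : Tournament n} ((σ , _) : S ≅ T) →
  ∀ {a b c} → Cycle T a b c → Cycle S (Inverse.from σ a) (Inverse.from σ b) (Inverse.from σ c)
≅-from-cycle {S = S} {T} iso {a} {b} {c} (ab , bc , ca) =
  trans (from-adj a b) ab , trans (from-adj b c) bc , trans (from-adj c a) ca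
  where from-adj = ≅-from-adj {S = S} {T} iso

does-<?⇒< : ∀ {n} {i j : Fin n} → does (i <? j) ≡ true → i < j
does-<?⇒< {i = i} {j} h = ℕ.<ᵇ⇒< (toℕ i) (toℕ j) (subst T (sym h) _)

apexAdj : ∀ {L} → Vec Bool L → Fin (suc L) → Fin (suc L) → Bool
apexAdj s zero    zero    = false
apexAdj s zero    (suc j) = lookup s j
apexAdj s (suc i) zero    = not (lookup s i)
apexAdj s (suc i) (suc j) = does (i <? j)

apexTournament : ∀ {L} → Vec Bool L → Tournament (suc L)
apexTournament s = record { adj = apexAdj s ; irrefl = irrefl′ ; tourn = tourn′ }
  where
  irrefl′ : ∀ i → apexAdj s i i ≡ false
  irrefl′ zero    = refl
  irrefl′ (suc i) = dec-false (i <? i) (<-irrefl refl)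
  tourn′ : ∀ i j → i ≢ j → apexAdj s j i ≡ not (apexAdj s i j)
  tourn′ zero    zero    i≢j = ⊥-elim (i≢j refl)
  tourn′ zero    (suc j) _   = refl
  tourn′ (suc i) zero    _   = sym (not-involutive _)
  tourn′ (suc i) (suc j) i≢j with <-cmp i j
  ... | tri< i<j _ _ = trans (dec-false (j <? i) (<-asym i<j)) (cong not (sym (dec-true (i <? j) i<j)))
  ... | tri≈ _ i≡j _ = ⊥-elim (i≢j (cong suc i≡j))
  ... | tri> _ _ j<i = trans (dec-true (j <? i) j<i) (cong not (sym (dec-false (i <? j) (<-asym j<i))))

apex-adj⇒< : ∀ {L} (s : Vec Bool L) {u v} →
  adj (apexTournament s) u v ≡ true → u ≢ zero → v ≢ zero → u < v
apex-adj⇒< s {zero}          _ u≢0 _   = ⊥-elim (u≢0 refl)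
apex-adj⇒< s {suc i} {zero}  _ _   v≢0 = ⊥-elim (v≢0 refl)
apex-adj⇒< s {suc i} {suc j} h _   _   = s<s (does-<?⇒< h)

apex-on-every-cycle : ∀ {L} (s : Vec Bool L) {u v w} →
  u ≢ zero → v ≢ zero → w ≢ zero → ¬ Cycle (apexTournament s) u v w
apex-on-every-cycle s u≢0 v≢0 w≢0 (uv , vw , wu) =
  <-asym (<-trans (apex-adj⇒< s uv u≢0 v≢0) (apex-adj⇒< s vw v≢0 w≢0)) (apex-adj⇒< s wu w≢0 u≢0)

Inversion⇒apex-cycle : ∀ {L} (s : Vec Bool L) {i j} →
  Inversion s i j → Cycle (apexTournament s) zero (suc i) (suc j)
Inversion⇒apex-cycle s {i} {j} (i<j , sᵢ , sⱼ) = sᵢ , dec-true (i <? j) i<j , cong not sⱼ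

apex-≅-fixes-apex : ∀ {L} {s t : Vec Bool L} → RobustlyInverted t →
  ((σ , _) : apexTournament s ≅ apexTournament t) → Inverse.to σ zero ≡ zero
apex-≅-fixes-apex {s = s} {t} robust iso@(σ , _) with Inverse.to σ zero in σ0
... | zero  = refl
... | suc k with robust k
... | i , j , i≢k , j≢k , inv =
  ⊥-elim (apex-on-every-cycle s (off-apex {zero} (λ ())) (off-apex (i≢k ∘ suc-injective))
                                (off-apex (j≢k ∘ suc-injective))
           (≅-from-cycle {S = apexTournament s} {apexTournament t} iso (Inversion⇒apex-cycle t inv)))
  where
  open Inverse σ using (to; from; strictlyInverseˡ)
  off-apex : ∀ {a} → a ≢ suc k → from a ≢ zero
  off-apex {a} a≢ from≡0 = a≢ (trans (sym (strictlyInverseˡ a)) (trans (cong to from≡0) σ0))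

apex-≅-monotone : ∀ {L} {s t : Vec Bool L} → RobustlyInverted t →
  ((σ , _) : apexTournament s ≅ apexTournament t) → Inverse.to σ Preserves _<_ ⟶ _<_
apex-≅-monotone {s = s} {t} robust iso@(σ , σ-adj) {a} {b} = go a b
  where
  open Inverse σ using (to)
  σ0 = apex-≅-fixes-apex robust iso
  to-off-apex : ∀ {a} → a ≢ zero → to a ≢ zero
  to-off-apex a≢0 to≡0 = a≢0 (Injection.injective (Inverse⇒Injection σ) (trans to≡0 (sym σ0)))
  go : ∀ a b → a < b → to a < to b
  go zero    (suc j) _ with to (suc j) in e
  ... | zero  = ⊥-elim (to-off-apex (λ ()) e)
  ... | suc _ rewrite σ0 = z<s
  go (suc i) (suc j) (s<s i<j) =
    apex-adj⇒< t (trans (sym (σ-adj (suc i) (suc j))) (dec-true (i <? j) i<j))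
                 (to-off-apex (λ ())) (to-off-apex (λ ()))

apexTournament-rigid : ∀ {L} {s t : Vec Bool L} →
  RobustlyInverted t → apexTournament s ≅ apexTournament t → s ≡ t
apexTournament-rigid {s = s} {t} robust iso@(σ , σ-adj) = begin
  s                   ≡⟨ tabulate∘lookup s ⟨
  tabulate (lookup s) ≡⟨ tabulate-cong lookup-agrees ⟩
  tabulate (lookup t) ≡⟨ tabulate∘lookup t ⟩
  t                   ∎
  where
  open ≡-Reasoning
  fixed = strictMono-↔⇒id σ (apex-≅-monotone robust iso)
  lookup-agrees : ∀ i → lookup s i ≡ lookup t i
  lookup-agrees i = trans (σ-adj zero (suc i)) (cong₂ (apexAdj t) (fixed zero) (fixed (suc i)))

module _ {k} (a : Fin (2 * k) → Bool)
         (alternating : ∀ p q → toℕ q ≡ suc (toℕ p) → a p ≡ not (a q)) where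

  consecutive-cover : ∀ b p q → toℕ q ≡ suc (toℕ p) → a p ≡ b ⊎ a q ≡ b
  consecutive-cover b p q q≡p+1 with a p ≟ b
  ... | yes aₚ≡b = inj₁ aₚ≡b
  ... | no  aₚ≢b = inj₂ (not-injective (trans (sym (alternating p q q≡p+1)) (¬-not aₚ≢b)))

  -- The letter s_i is read at position 2i or 2i+1.
  alternating⇒subsequence : ∀ {L} → L ≤ k → (s : Vec Bool L) →
    Σ (Fin L → Fin (2 * k)) λ pick → pick Preserves _<_ ⟶ _<_ × (∀ i → a (pick i) ≡ lookup s i)
  alternating⇒subsequence {L} L≤k s = proj₁ ∘ choose , pick-mono , proj₂ ∘ proj₂ ∘ choose
    where
    2i+1<2k : ∀ (i : Fin L) → suc (2 * toℕ i) ℕ.< 2 * k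
    2i+1<2k i = subst (_≤ 2 * k) (ℕ.*-suc 2 (toℕ i)) (ℕ.*-monoʳ-≤ 2 (ℕ.≤-trans (toℕ<n i) L≤k))

    Near : Fin L → Fin (2 * k) → Set
    Near i p = 2 * toℕ i ≤ toℕ p × toℕ p ≤ suc (2 * toℕ i)

    even odd : Fin L → Fin (2 * k)
    even i = fromℕ< (ℕ.<-trans (ℕ.n<1+n _) (2i+1<2k i))
    odd  i = fromℕ< (2i+1<2k i)

    toℕ-even : ∀ i → toℕ (even i) ≡ 2 * toℕ i
    toℕ-even i = toℕ-fromℕ< _

    toℕ-odd : ∀ i → toℕ (odd i) ≡ suc (2 * toℕ i)
    toℕ-odd i = toℕ-fromℕ< _

    near-even : ∀ i → Near i (even i)
    near-even i = ℕ.≤-reflexive (sym (toℕ-even i)) , ℕ.m≤n⇒m≤1+n (ℕ.≤-reflexive (toℕ-even i))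

    near-odd : ∀ i → Near i (odd i)
    near-odd i = subst (2 * toℕ i ≤_) (sym (toℕ-odd i)) (ℕ.n≤1+n _) , ℕ.≤-reflexive (toℕ-odd i)

    choose : ∀ i → Σ (Fin (2 * k)) λ p → Near i p × a p ≡ lookup s i
    choose i with consecutive-cover (lookup s i) (even i) (odd i)
                    (trans (toℕ-odd i) (cong suc (sym (toℕ-even i))))
    ... | inj₁ aₑ = even i , near-even i , aₑ
    ... | inj₂ aₒ = odd i , near-odd i , aₒ

    pick-mono : (proj₁ ∘ choose) Preserves _<_ ⟶ _<_
    pick-mono {i} {j} i<j with choose i | choose j
    ... | p , (_ , p≤2i+1) , _ | q , (2j≤q , _) , _ = begin-strict
      toℕ p                 ≤⟨ p≤2i+1 ⟩
      suc (2 * toℕ i)       <⟨ ℕ.n<1+n _ ⟩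
      suc (suc (2 * toℕ i)) ≡⟨ ℕ.*-suc 2 (toℕ i) ⟨
      2 * suc (toℕ i)       ≤⟨ ℕ.*-monoʳ-≤ 2 i<j ⟩
      2 * toℕ j             ≤⟨ 2j≤q ⟩
      toℕ q                 ∎
      where open ℕ.≤-Reasoning

Type1⇒apexTournament↪ : ∀ {N k L} (T : Tournament N) → L ≤ k → Type1 k T →
  (s : Vec Bool L) → apexTournament s ↪ T
Type1⇒apexTournament↪ {N} {k} {L} T L≤k (x , y , x-inj , y∉x , x-incr , alt) s = f , f-inj , f-adj
  where
  alternating : ∀ p q → toℕ q ≡ suc (toℕ p) → adj T y (x p) ≡ not (adj T y (x q))
  alternating p q q≡p+1 = trans (alt p q q≡p+1) (tourn T y (x q) (y∉x q))

  subsequence = alternating⇒subsequence (λ p → adj T y (x p)) alternating L≤k s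

  pick : Fin L → Fin (2 * k)
  pick = proj₁ subsequence

  pick-mono : pick Preserves _<_ ⟶ _<_
  pick-mono = proj₁ (proj₂ subsequence)

  pick-sound : ∀ i → adj T y (x (pick i)) ≡ lookup s i
  pick-sound = proj₂ (proj₂ subsequence)

  pick-inj : Injective _≡_ _≡_ pick
  pick-inj = strictMono⇒injective pick-mono

  f : Fin (suc L) → Fin N
  f zero    = y
  f (suc i) = x (pick i)

  f-inj : Injective _≡_ _≡_ f
  f-inj {zero}  {zero}  _  = refl
  f-inj {zero}  {suc j} eq = ⊥-elim (y∉x (pick j) eq)
  f-inj {suc i} {zero}  eq = ⊥-elim (y∉x (pick i) (sym eq))
  f-inj {suc i} {suc j} eq = cong suc (pick-inj (x-inj eq))

  f-adj : ∀ u v → apexAdj s u v ≡ adj T (f u) (f v)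
  f-adj zero    zero    = sym (irrefl T y)
  f-adj zero    (suc j) = sym (pick-sound j)
  f-adj (suc i) zero    = sym (trans (tourn T y (x (pick i)) (y∉x (pick i))) (cong not (pick-sound i)))
  f-adj (suc i) (suc j) = sym (increasing⇒adj≡does T (x ∘ pick) (pick-inj ∘ x-inj) x-pick-incr i j)
    where
    x-pick-incr : ∀ i j → i < j → adj T (x (pick i)) (x (pick j)) ≡ true
    x-pick-incr i j = x-incr (pick i) (pick j) ∘ pick-mono

AtLeast-≤ : ∀ (P : Property) {n m m′} → m ≤ m′ → AtLeast P n m′ → AtLeast P n m
AtLeast-≤ P m≤m′ (F , F∈P , F-distinct) =
  F ∘ inj , F∈P ∘ inj ,
  λ i j F≅F → inject≤-injective m≤m′ m≤m′ i j (F-distinct (inj i) (inj j) F≅F)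
  where
  inj : Fin _ → Fin _
  inj i = inject≤ i m≤m′

AtLeast-robust-apexTournaments : ∀ (P : Property) {L} →
  (∀ (s : Vec Bool L) → P (apexTournament s)) → AtLeast P (suc L) (count L robust)
AtLeast-robust-apexTournaments P {L} apexTournament∈P =
  apexTournament ∘ word , apexTournament∈P ∘ word , distinct
  where
  word : Fin (count L robust) → Vec Bool L
  word = enumerate L robust
  distinct : ∀ i j → apexTournament (word i) ≅ apexTournament (word j) → i ≡ j
  distinct i j iso = enumerate-injective L robust i j
    (apexTournament-rigid (robust-sound (word j) (enumerate-sound L robust j)) iso)

emptyTournament : Tournament 0
emptyTournament = record { adj = λ () ; irrefl = λ () ; tourn = λ () }

emptyTournament↪ : ∀ {N} (T : Tournament N) → emptyTournament ↪ T
emptyTournament↪ T = (λ ()) , (λ { {()} }) , (λ ())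

lemma9 : (P : Property) → Hereditary P →
    (∀ K → Σ ℕ λ k → K ≤ k × OccursType1 P k) →
    ∀ n → AtLeast P n (2 ^ (n ∸ 1) ∸ 2 * ((n ∸ 1) C 2) ∸ n)
lemma9 P (_ , ↪-closed) occurs zero with occurs 0
... | _ , _ , _ , T , T∈P , _ =
  (λ _ → emptyTournament) , (λ _ → ↪-closed emptyTournament T (emptyTournament↪ T) T∈P) ,
  λ { zero zero _ → refl }
lemma9 P (_ , ↪-closed) occurs (suc L) with occurs L
... | _ , L≤k , _ , T , T∈P , structure =
  AtLeast-≤ P (count-robust L) (AtLeast-robust-apexTournaments P apexTournament∈P)
  where
  apexTournament∈P : ∀ s → P (apexTournament s)
  apexTournament∈P s = ↪-closed (apexTournament s) T (Type1⇒apexTournament↪ T L≤k structure s) T∈P
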